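{- Let $\mathcal{H}$ be a finite family of digraphs and let $P\in\mathcal{H}$ be a directed path of length $p$. For each $H^*\in\mathcal{H}^+_p$, there exists a subgraph $H'$ of $H^*$ that is isomorphic to a member of $GPC(P)$.
   Context: For a digraph $H$, $GPC(H)$ (good path completions) consists of all strongly connected digraphs of the form $H\cup P_1\cup\dots\cup P_\ell$, where each $P_i$ is a directed path with both end-points in $V(H)$ (paths not necessarily disjoint), no two of the paths having the same ordered pair of end-points; $\{P_1,\dots,P_\ell\}$ is a witnessing collection of paths. $GPC(\mathcal{H})=\bigcup_{H\in\mathcal{H}}GPC(H)$. $\mathcal{H}^-_p$ is the set of digraphs in $GPC(\mathcal{H})$ that have some witnessing collection of paths in which every path has length at most $p-1$; $\mathcal{H}^+_p=GPC(\mathcal{H})\setminus\mathcal{H}^-_p$. Length of a path is its number of arcs. -}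

module Defs where

open import Data.Nat using (ℕ; zero; suc; _<_; _≤_)
open import Data.Fin using (Fin; toℕ; inject₁) renaming (suc to fsuc)
open import Data.Bool using (Bool; true; false; _∧_)
open import Data.List using (List; []; _∷_; length)
open import Data.List.Membership.Propositional using (_∈_)
open import Data.List.Relation.Unary.All using (All)
open import Data.List.Relation.Unary.Any using (Any)
open import Data.List.Relation.Unary.AllPairs using (AllPairs)
open import Data.List.Relation.Unary.Unique.Propositional using (Unique)
open import Data.List.Relation.Unary.Linked using (Linked)
open import Data.Product using (Σ; ∃; ∃-syntax; _×_; _,_)
open import Data.Sum using (_⊎_)
open import Relation.Binary.PropositionalEquality using (_≡_; _≢_)
open import Relation.Nullary using (¬_)
open import Function.Definitions using (Injective)
open import Data.Empty using (⊥-elim)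
open import Data.Nat.Properties using (1+n≢n)
open import Relation.Nullary using (yes; no)
open import Relation.Binary.PropositionalEquality using (sym; refl)
open import Data.Nat using (_≟_)

record Digraph : Set where
  field
    size     : ℕ
    arc      : Fin size → Fin size → Bool
    loopless : ∀ v → arc v v ≡ false
open Digraph public

Arc : (G : Digraph) → Fin (size G) → Fin (size G) → Set
Arc G u v = arc G u v ≡ true

-- Subgraph up to relabelling: an injective arc-preserving vertex map.
record Subgraph (H G : Digraph) : Set where
  field
    map      : Fin (size H) → Fin (size G)
    injective : Injective _≡_ _≡_ map
    arcs     : ∀ u v → Arc H u v → Arc G (map u) (map v)

record Iso (H G : Digraph) : Set where
  field
    to        : Fin (size H) → Fin (size G)
    from      : Fin (size G) → Fin (size H)
    from-to   : ∀ v → from (to v) ≡ v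
    to-from   : ∀ v → to (from v) ≡ v
    arcs      : ∀ u v → Arc H u v → Arc G (to u) (to v)
    arcs⁻     : ∀ u v → Arc G u v → Arc H (from u) (from v)

PathDigraph : ℕ → Digraph
PathDigraph p = record
  { size = suc p
  ; arc = λ u v → isSucc u v
  ; loopless = λ v → isSucc-irr v
  }
  where
  isSucc : {m : ℕ} → Fin m → Fin m → Bool
  isSucc u v with _≟_ (suc (toℕ u)) (toℕ v)
  ... | yes _ = true
  ... | no _ = false
  isSucc-irr : {m : ℕ} (v : Fin m) → isSucc v v ≡ false
  isSucc-irr v with _≟_ (suc (toℕ v)) (toℕ v)
  ... | yes e = ⊥-elim (1+n≢n e)
  ... | no _ = refl

IsDirectedPath : Digraph → ℕ → Set
IsDirectedPath D p = Iso D (PathDigraph p)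

data Reach (G : Digraph) : Fin (size G) → Fin (size G) → Set where
  here  : ∀ {u} → Reach G u u
  there : ∀ {u v w} → Arc G u v → Reach G v w → Reach G u w

StronglyConnected : Digraph → Set
StronglyConnected G = ∀ u v → Reach G u v

lastV : {A : Set} → A → List A → A
lastV x []       = x
lastV x (y ∷ ys) = lastV y ys

record DPath (G : Digraph) : Set where
  field
    start    : Fin (size G)
    rest     : List (Fin (size G))
    distinct : Unique (start ∷ rest)
    linked   : Linked (Arc G) (start ∷ rest)
open DPath public

verts : {G : Digraph} → DPath G → List (Fin (size G))
verts P = start P ∷ rest P

-- length = number of arcs
len : {G : Digraph} → DPath G → ℕ
len P = length (rest P)

end : {G : Digraph} → DPath G → Fin (size G)
end P = lastV (start P) (rest P)

data Consec {A : Set} (u v : A) : List A → Set where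
  now   : ∀ {xs} → Consec u v (u ∷ v ∷ xs)
  later : ∀ {x xs} → Consec u v xs → Consec u v (x ∷ xs)

-- G ∈ GPC(H): G is strongly connected and G = H ∪ P₁ ∪ … ∪ Pℓ, where
-- H sits inside G via an embedding, each Pᵢ is a directed path of G
-- (with at least one arc) whose end-points lie in V(H), no two paths
-- share the same ordered pair of end-points, and every vertex and arc
-- of G comes from H or from some Pᵢ.

InImage : (H G : Digraph) → (Fin (size H) → Fin (size G)) → Fin (size G) → Set
InImage H G f v = ∃[ x ] f x ≡ v

record GPCWitness (H G : Digraph) : Set where
  field
    emb        : Subgraph H G
  ι : Fin (size H) → Fin (size G)
  ι = Subgraph.map emb
  field
    paths      : List (DPath G)
    nontrivial : All (λ P → 1 ≤ len P) paths
    endpoints  : All (λ P → InImage H G ι (start P)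
                           × InImage H G ι (end P)) paths
    distinctEnds : AllPairs (λ P Q → (start P , end P) ≢ (start Q , end Q)) paths
    coverV     : ∀ v → InImage H G ι v ⊎ Any (λ P → v ∈ verts P) paths
    coverA     : ∀ u v → Arc G u v →
                 (∃[ x ] ∃[ y ] (ι x ≡ u × ι y ≡ v × Arc H x y))
                 ⊎ Any (λ P → Consec u v (verts P)) paths
    strong     : StronglyConnected G
open GPCWitness public

GPC : Digraph → Digraph → Set
GPC H G = GPCWitness H G

GPCFam : List Digraph → Digraph → Set
GPCFam 𝓗 G = ∃[ H ] (H ∈ 𝓗 × GPC H G)

-- G ∈ 𝓗⁻ₚ : some witness in which every path has length ≤ p - 1, i.e. < p
Minus : List Digraph → ℕ → Digraph → Set
Minus 𝓗 p G = ∃[ H ] (H ∈ 𝓗 × Σ (GPCWitness H G) (λ W → All (λ P → len P < p) (paths W)))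

Plus : List Digraph → ℕ → Digraph → Set
Plus 𝓗 p G = GPCFam 𝓗 G × ¬ Minus 𝓗 p G

-- Since Hs lies outside 𝓗⁻ₚ, every witnessing collection of Hs contains a path of
-- length at least p; its initial segment π of length p is a copy of P. Strong
-- connectivity of Hs gives a walk from the end of π back to its start, and cutting
-- out its cycles leaves a path ρ. The union of π and ρ is then a strongly connected
-- subgraph of Hs, and it is P completed by the single path ρ (by no path at all
-- when p = 0, as ρ is then trivial).

module Submission where

open import Defs
open import Data.Nat using (ℕ; zero; suc; _≤_; _<?_; s≤s; z≤n; pred)
open import Data.Nat.Properties using (≮⇒≥; m≤n⇒m⊓n≡m)
open import Data.Bool using (true)
open import Data.Fin using (Fin; toℕ; _≟_) renaming (zero to fzero; suc to fsuc)
open import Data.List using (List; []; _∷_; length; _++_; lookup; take; map; deduplicate)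
open import Data.List.Properties using (∷-injective; length-map; length-take)
open import Data.List.Membership.Propositional using (_∈_)
open import Data.List.Membership.Propositional.Properties
  using (∈-lookup; ∈-map⁻; ∈-++⁺ˡ; ∈-++⁺ʳ; ∈-++⁻; ∈-deduplicate⁺; ∈-deduplicate⁻)
open import Data.List.Relation.Unary.All as All using (All; []; _∷_)
open import Data.List.Relation.Unary.All.Properties using (¬All⇒Any¬; ¬Any⇒All¬)
open import Data.List.Relation.Unary.Any as Any using (Any; here; there)
open import Data.List.Relation.Unary.Any.Properties using (lookup-index)
open import Data.List.Relation.Unary.AllPairs using ([]; _∷_)
open import Data.List.Relation.Unary.Unique.Propositional using (Unique)
import Data.List.Relation.Unary.Unique.Propositional.Properties as Uniqueₚ
open import Data.List.Relation.Unary.Linked as Linked using (Linked; []; [-]; _∷_)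
import Data.List.Relation.Unary.Linked.Properties as Linkedₚ
open import Data.Product as Product using (Σ; ∃₂; ∃-syntax; _×_; _,_; proj₁; proj₂)
open import Data.Sum as Sum using (_⊎_; inj₁; inj₂; [_,_]′)
open import Data.Empty using (⊥-elim)
open import Function.Definitions using (Injective)
open import Relation.Nullary using (¬_; Dec; yes; no; does; _⊎-dec_)
open import Relation.Nullary.Decidable using (dec-true; dec-false)
open import Relation.Binary.Definitions using (DecidableEquality)
open import Relation.Binary.PropositionalEquality
  using (_≡_; refl; sym; trans; cong; cong₂; subst; subst₂)

does-true⇒ : {A : Set} (a? : Dec A) → does a? ≡ true → A
does-true⇒ (yes a) _ = a
does-true⇒ (no _) ()

module _ {A : Set} where

  lastV-∈ : ∀ (x : A) xs → lastV x xs ∈ x ∷ xs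
  lastV-∈ x []       = here refl
  lastV-∈ x (y ∷ xs) = there (lastV-∈ y xs)

  lastV-map : ∀ {B : Set} (f : A → B) x xs → lastV (f x) (map f xs) ≡ f (lastV x xs)
  lastV-map f x []       = refl
  lastV-map f x (y ∷ xs) = lastV-map f y xs

  []-or-nonempty : (xs : List A) → xs ≡ [] ⊎ 1 ≤ length xs
  []-or-nonempty []      = inj₁ refl
  []-or-nonempty (_ ∷ _) = inj₂ (s≤s z≤n)

  ∈-singleton : ∀ {v x : A} {xs} → xs ≡ [] → v ∈ x ∷ xs → v ≡ x
  ∈-singleton refl (here v≡x) = v≡x

  ¬Consec-singleton : ∀ {u v x : A} {xs} → xs ≡ [] → ¬ Consec u v (x ∷ xs)
  ¬Consec-singleton refl (later ())

  lookup-injective : ∀ {xs : List A} → Unique xs → Injective _≡_ _≡_ (lookup xs)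
  lookup-injective {x ∷ xs} _        {fzero}  {fzero}  _ = refl
  lookup-injective {x ∷ xs} (x∉ ∷ _) {fzero}  {fsuc j} e = ⊥-elim (All.lookup x∉ (∈-lookup j) e)
  lookup-injective {x ∷ xs} (x∉ ∷ _) {fsuc i} {fzero}  e = ⊥-elim (All.lookup x∉ (∈-lookup i) (sym e))
  lookup-injective {x ∷ xs} (_ ∷ U)  {fsuc i} {fsuc j} e = cong fsuc (lookup-injective U e)

  map-preimage : ∀ {B : Set} (f : B → A) {xs} → All (λ x → ∃[ b ] f b ≡ x) xs →
                 ∃[ bs ] map f bs ≡ xs
  map-preimage f []              = [] , refl
  map-preimage f ((b , fb) ∷ ps) with map-preimage f ps
  ... | bs , fbs = b ∷ bs , cong₂ _∷_ fb fbs

  Linked-take : ∀ {R : A → A → Set} n {xs} → Linked R xs → Linked R (take n xs)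
  Linked-take zero          _         = []
  Linked-take (suc n)       []        = []
  Linked-take (suc zero)    [-]       = [-]
  Linked-take (suc (suc n)) [-]       = [-]
  Linked-take (suc zero)    (_ ∷ _)   = [-]
  Linked-take (suc (suc n)) (r ∷ rs)  = r ∷ Linked-take (suc n) rs

  consec? : DecidableEquality A → ∀ u v xs → Dec (Consec u v xs)
  consec? _≟A_ u v []           = no λ ()
  consec? _≟A_ u v (x ∷ [])     = no λ { (later ()) }
  consec? _≟A_ u v (x ∷ y ∷ xs) with u ≟A x | v ≟A y | consec? _≟A_ u v (y ∷ xs)
  ... | yes refl | yes refl | _     = yes now
  ... | _        | _        | yes c = yes (later c)
  ... | no u≢x   | _        | no ¬c = no λ { now → u≢x refl ; (later c) → ¬c c }
  ... | yes _    | no v≢y   | no ¬c = no λ { now → v≢y refl ; (later c) → ¬c c }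

  Unique⇒¬Consec-refl : ∀ {u : A} {xs} → Unique xs → ¬ Consec u u xs
  Unique⇒¬Consec-refl ((u≢ ∷ _) ∷ _) now       = u≢ refl
  Unique⇒¬Consec-refl (_ ∷ U)        (later c) = Unique⇒¬Consec-refl U c

  Linked-Consec⇒R : ∀ {R : A → A → Set} {u v xs} → Linked R xs → Consec u v xs → R u v
  Linked-Consec⇒R (r ∷ _)  now       = r
  Linked-Consec⇒R (_ ∷ rs) (later c) = Linked-Consec⇒R rs c

  Linked-Consec : (xs : List A) → Linked (λ a b → Consec a b xs) xs
  Linked-Consec []           = []
  Linked-Consec (x ∷ [])     = [-]
  Linked-Consec (x ∷ y ∷ xs) = now ∷ Linked.map later (Linked-Consec (y ∷ xs))

  Consec-lookup : (xs : List A) (i j : Fin (length xs)) → suc (toℕ i) ≡ toℕ j →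
                  Consec (lookup xs i) (lookup xs j) xs
  Consec-lookup (x ∷ y ∷ xs) fzero    (fsuc fzero) _ = now
  Consec-lookup (x ∷ xs)     (fsuc i) (fsuc j)     e = later (Consec-lookup xs i j (cong pred e))

  Consec⇒lookup : ∀ {u v} (xs : List A) → Consec u v xs →
                  ∃₂ λ i j → lookup xs i ≡ u × lookup xs j ≡ v × suc (toℕ i) ≡ toℕ j
  Consec⇒lookup (x ∷ y ∷ xs) now = fzero , fsuc fzero , refl , refl , refl
  Consec⇒lookup (x ∷ xs) (later c) with Consec⇒lookup xs c
  ... | i , j , li , lj , e = fsuc i , fsuc j , li , lj , cong suc e

  Consec-map⁻ : ∀ {B : Set} (f : B → A) {u v} xs → Consec u v (map f xs) →
                ∃₂ λ x y → f x ≡ u × f y ≡ v × Consec x y xs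
  Consec-map⁻ f (x ∷ y ∷ xs) now       = x , y , refl , refl , now
  Consec-map⁻ f (x ∷ xs)     (later c) with Consec-map⁻ f xs c
  ... | a , b , fa , fb , c′ = a , b , fa , fb , later c′

module _ {G : Digraph} where

  Reach-trans : ∀ {u v w} → Reach G u v → Reach G v w → Reach G u w
  Reach-trans here        s = s
  Reach-trans (there a r) s = there a (Reach-trans r s)

  Linked⇒Reach-head : ∀ {v} x xs → Linked (Arc G) (x ∷ xs) → v ∈ x ∷ xs → Reach G x v
  Linked⇒Reach-head x xs       _        (here refl) = here
  Linked⇒Reach-head x (y ∷ xs) (a ∷ as) (there v∈)  = there a (Linked⇒Reach-head y xs as v∈)

  Linked⇒Reach-lastV : ∀ {v} x xs → Linked (Arc G) (x ∷ xs) → v ∈ x ∷ xs → Reach G v (lastV x xs)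
  Linked⇒Reach-lastV x []       _        (here refl) = here
  Linked⇒Reach-lastV x (y ∷ xs) (a ∷ as) (here refl) = there a (Linked⇒Reach-lastV y xs as (here refl))
  Linked⇒Reach-lastV x (y ∷ xs) (_ ∷ as) (there v∈)  = Linked⇒Reach-lastV y xs as v∈

  start-Reach : ∀ {v} (σ : DPath G) → v ∈ verts σ → Reach G (start σ) v
  start-Reach σ = Linked⇒Reach-head (start σ) (rest σ) (linked σ)

  Reach-end : ∀ {v} (σ : DPath G) → v ∈ verts σ → Reach G v (end σ)
  Reach-end σ = Linked⇒Reach-lastV (start σ) (rest σ) (linked σ)

  takePath : ℕ → DPath G → DPath G
  takePath n σ = record
    { start    = start σ
    ; rest     = take n (rest σ)
    ; distinct = Uniqueₚ.take⁺ (suc n) (distinct σ)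
    ; linked   = Linked-take (suc n) (linked σ)
    }

  len-takePath : ∀ {n} (σ : DPath G) → n ≤ len σ → len (takePath n σ) ≡ n
  len-takePath {n} σ n≤ = trans (length-take n (rest σ)) (m≤n⇒m⊓n≡m n≤)

  suffixPath : ∀ {v} (σ : DPath G) → v ∈ verts σ →
               Σ (DPath G) λ τ → start τ ≡ v × end τ ≡ end σ
  suffixPath σ (here refl) = σ , refl , refl
  suffixPath record { start = x ; rest = y ∷ ys ; distinct = _ ∷ U ; linked = _ ∷ as } (there v∈) =
    suffixPath record { start = y ; rest = ys ; distinct = U ; linked = as } v∈

  Reach⇒DPath : ∀ {u v} → Reach G u v → Σ (DPath G) λ σ → start σ ≡ u × end σ ≡ v
  Reach⇒DPath {u} here = record { start = u ; rest = [] ; distinct = [] ∷ [] ; linked = [-] } , refl , refl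
  Reach⇒DPath {u} (there a r) with Reach⇒DPath r
  ... | σ , refl , refl with Any.any? (u ≟_) (verts σ)
  ...   | yes u∈ = suffixPath σ u∈
  ...   | no u∉  = record
    { start    = u
    ; rest     = verts σ
    ; distinct = ¬Any⇒All¬ (verts σ) u∉ ∷ distinct σ
    ; linked   = a ∷ linked σ
    } , refl , refl

PathDigraph-arc⇒ : ∀ {k} (i j : Fin (suc k)) → Arc (PathDigraph k) i j → suc (toℕ i) ≡ toℕ j
PathDigraph-arc⇒ i j a with Data.Nat._≟_ (suc (toℕ i)) (toℕ j)
... | yes e = e
PathDigraph-arc⇒ i j () | no _

PathDigraph-arc⇐ : ∀ {k} (i j : Fin (suc k)) → suc (toℕ i) ≡ toℕ j → Arc (PathDigraph k) i j
PathDigraph-arc⇐ i j e with Data.Nat._≟_ (suc (toℕ i)) (toℕ j)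
... | yes _  = refl
... | no i↛j = ⊥-elim (i↛j e)

module _ {G : Digraph} (σ : DPath G) where

  DPath⇒Subgraph : Subgraph (PathDigraph (len σ)) G
  DPath⇒Subgraph = record
    { map       = lookup (verts σ)
    ; injective = lookup-injective (distinct σ)
    ; arcs      = λ i j a →
        Linked-Consec⇒R (linked σ) (Consec-lookup (verts σ) i j (PathDigraph-arc⇒ i j a))
    }

  ∈-verts⇒InImage : ∀ {v} → v ∈ verts σ → InImage (PathDigraph (len σ)) G (lookup (verts σ)) v
  ∈-verts⇒InImage v∈ = Any.index v∈ , sym (lookup-index v∈)

  Consec-verts⇒PathArc : ∀ {u v} → Consec u v (verts σ) →
    ∃[ i ] ∃[ j ] (lookup (verts σ) i ≡ u × lookup (verts σ) j ≡ v × Arc (PathDigraph (len σ)) i j)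
  Consec-verts⇒PathArc c with Consec⇒lookup (verts σ) c
  ... | i , j , li , lj , e = i , j , li , lj , PathDigraph-arc⇐ i j e

module _ {H G : Digraph} (e : Subgraph H G) where

  open Subgraph e using (injective) renaming (map to φ)

  liftPath : (σ : DPath G) → All (InImage H G φ) (verts σ) →
             (∀ {x y} → Consec (φ x) (φ y) (verts σ) → Arc H x y) →
             Σ (DPath H) λ σ̂ → map φ (verts σ̂) ≡ verts σ
  liftPath σ ((s , ms) ∷ inRest) arcs with map-preimage φ inRest
  ... | rs , mrs = σ̂ , lifts
    where
    lifts : map φ (s ∷ rs) ≡ verts σ
    lifts = cong₂ _∷_ ms mrs

    σ̂ : DPath H
    σ̂ = record
      { start    = s
      ; rest     = rs
      ; distinct = Uniqueₚ.map⁻ (subst Unique (sym lifts) (distinct σ))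
      ; linked   = Linked.map arcs
          (Linkedₚ.map⁻ (subst (Linked (λ a b → Consec a b (verts σ))) (sym lifts) (Linked-Consec (verts σ))))
      }

  module Lifted {σ̂ : DPath H} {σ : DPath G} (lifts : map φ (verts σ̂) ≡ verts σ) where

    lift-start : φ (start σ̂) ≡ start σ
    lift-start = proj₁ (∷-injective lifts)

    lift-end : φ (end σ̂) ≡ end σ
    lift-end = trans (sym (lastV-map φ (start σ̂) (rest σ̂)))
                     (cong₂ lastV (proj₁ (∷-injective lifts)) (proj₂ (∷-injective lifts)))

    lift-len : len σ̂ ≡ len σ
    lift-len = trans (sym (length-map φ (rest σ̂))) (cong length (proj₂ (∷-injective lifts)))

    lift-∈ : ∀ {v} → φ v ∈ verts σ → v ∈ verts σ̂
    lift-∈ {v} v∈ with ∈-map⁻ φ (subst (φ v ∈_) (sym lifts) v∈)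
    ... | w , w∈ , e = subst (_∈ verts σ̂) (sym (injective e)) w∈

    lift-Consec : ∀ {u v} → Consec (φ u) (φ v) (verts σ) → Consec u v (verts σ̂)
    lift-Consec {u} {v} c with Consec-map⁻ φ (verts σ̂) (subst (Consec (φ u) (φ v)) (sym lifts) c)
    ... | x , y , mx , my , c′ = subst₂ (λ a b → Consec a b (verts σ̂)) (injective mx) (injective my) c′

Iso-refl : ∀ {G} → Iso G G
Iso-refl = record
  { to = λ v → v ; from = λ v → v ; from-to = λ _ → refl ; to-from = λ _ → refl
  ; arcs = λ _ _ a → a ; arcs⁻ = λ _ _ a → a }

module _ {H H′ G : Digraph} (H≅H′ : Iso H H′) where

  open Iso H≅H′

  GPC-resp-Iso : GPC H′ G → GPC H G
  GPC-resp-Iso W = record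
    { emb          = emb′
    ; paths        = paths W
    ; nontrivial   = nontrivial W
    ; endpoints    = All.map (Product.map InImage-from InImage-from) (endpoints W)
    ; distinctEnds = distinctEnds W
    ; coverV       = λ v → Sum.map₁ InImage-from (coverV W v)
    ; coverA       = λ u v a → Sum.map₁ arc-from (coverA W u v a)
    ; strong       = strong W
    }
    where
    emb′ : Subgraph H G
    emb′ = record
      { map       = λ x → ι W (to x)
      ; injective = λ {x} {y} e →
          trans (sym (from-to x)) (trans (cong from (Subgraph.injective (emb W) e)) (from-to y))
      ; arcs      = λ x y a → Subgraph.arcs (emb W) (to x) (to y) (arcs x y a)
      }

    InImage-from : ∀ {v} → InImage H′ G (ι W) v → InImage H G (Subgraph.map emb′) v
    InImage-from (x , ιx≡v) = from x , trans (cong (ι W) (to-from x)) ιx≡v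

    arc-from : ∀ {u v} → ∃[ x ] ∃[ y ] (ι W x ≡ u × ι W y ≡ v × Arc H′ x y) →
               ∃[ x ] ∃[ y ] (Subgraph.map emb′ x ≡ u × Subgraph.map emb′ y ≡ v × Arc H x y)
    arc-from (x , y , ιx≡u , ιy≡v , a) =
      from x , from y , trans (cong (ι W) (to-from x)) ιx≡u , trans (cong (ι W) (to-from y)) ιy≡v ,
      arcs⁻ x y a

module _ {G : Digraph} (π ρ : DPath G) (cover : ∀ v → v ∈ verts π ⊎ v ∈ verts ρ)
         (π→ρ : end π ≡ start ρ) (ρ→π : end ρ ≡ start π) where

  twoPaths⇒StronglyConnected : StronglyConnected G
  twoPaths⇒StronglyConnected u v = Reach-trans (toStart u) (fromStart v)
    where
    ρ-closes : Reach G (start ρ) (start π)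
    ρ-closes = subst (Reach G (start ρ)) ρ→π (Reach-end ρ (here refl))

    π-opens : Reach G (start π) (start ρ)
    π-opens = subst (Reach G (start π)) π→ρ (start-Reach π (lastV-∈ (start π) (rest π)))

    toStart : ∀ w → Reach G w (start π)
    toStart w with cover w
    ... | inj₁ w∈π = Reach-trans (subst (Reach G w) π→ρ (Reach-end π w∈π)) ρ-closes
    ... | inj₂ w∈ρ = subst (Reach G w) ρ→π (Reach-end ρ w∈ρ)

    fromStart : ∀ w → Reach G (start π) w
    fromStart w with cover w
    ... | inj₁ w∈π = start-Reach π w∈π
    ... | inj₂ w∈ρ = Reach-trans π-opens (start-Reach ρ w∈ρ)

  twoPaths⇒GPC : (∀ u v → Arc G u v → Consec u v (verts π) ⊎ Consec u v (verts ρ)) →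
                 GPC (PathDigraph (len π)) G
  twoPaths⇒GPC arc-cover with []-or-nonempty (rest ρ)
  ... | inj₁ ρ-rest = record
    { emb          = DPath⇒Subgraph π
    ; paths        = []
    ; nontrivial   = []
    ; endpoints    = []
    ; distinctEnds = []
    ; coverV       = λ v → inj₁ (∈-verts⇒InImage π ([ (λ v∈π → v∈π) , ρ⊆π ]′ (cover v)))
    ; coverA       = λ u v a → inj₁ (Consec-verts⇒PathArc π
        ([ (λ c → c) , (λ c → ⊥-elim (¬Consec-singleton ρ-rest c)) ]′ (arc-cover u v a)))
    ; strong       = twoPaths⇒StronglyConnected
    }
    where
    ρ⊆π : ∀ {v} → v ∈ verts ρ → v ∈ verts π
    ρ⊆π v∈ρ = subst (_∈ verts π) (sym (trans (∈-singleton ρ-rest v∈ρ) (sym π→ρ)))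
                (lastV-∈ (start π) (rest π))
  ... | inj₂ ρ-nontrivial = record
    { emb          = DPath⇒Subgraph π
    ; paths        = ρ ∷ []
    ; nontrivial   = ρ-nontrivial ∷ []
    ; endpoints    = (∈-verts⇒InImage π (subst (_∈ verts π) π→ρ (lastV-∈ (start π) (rest π))) ,
                      ∈-verts⇒InImage π (subst (_∈ verts π) (sym ρ→π) (here refl))) ∷ []
    ; distinctEnds = [] ∷ []
    ; coverV       = λ v → Sum.map (∈-verts⇒InImage π) here (cover v)
    ; coverA       = λ u v a → Sum.map (Consec-verts⇒PathArc π) here (arc-cover u v a)
    ; strong       = twoPaths⇒StronglyConnected
    }


module PathUnion {D : Digraph} (π ρ : DPath D) where

  open import Data.List.Relation.Unary.Unique.DecPropositional.Properties (_≟_ {size D})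
    using (deduplicate-!)

  vertexList : List (Fin (size D))
  vertexList = deduplicate _≟_ (verts π ++ verts ρ)

  vertex : Fin (length vertexList) → Fin (size D)
  vertex = lookup vertexList

  OnUnion : Fin (size D) → Fin (size D) → Set
  OnUnion u v = Consec u v (verts π) ⊎ Consec u v (verts ρ)

  onUnion? : ∀ u v → Dec (OnUnion u v)
  onUnion? u v = consec? _≟_ u v (verts π) ⊎-dec consec? _≟_ u v (verts ρ)

  union : Digraph
  union = record
    { size     = length vertexList
    ; arc      = λ i j → does (onUnion? (vertex i) (vertex j))
    ; loopless = λ i → dec-false (onUnion? (vertex i) (vertex i))
        [ Unique⇒¬Consec-refl (distinct π) , Unique⇒¬Consec-refl (distinct ρ) ]′
    }

  union⊆D : Subgraph union D
  union⊆D = record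
    { map       = vertex
    ; injective = lookup-injective (deduplicate-! (verts π ++ verts ρ))
    ; arcs      = λ i j a → [ Linked-Consec⇒R (linked π) , Linked-Consec⇒R (linked ρ) ]′
        (does-true⇒ (onUnion? (vertex i) (vertex j)) a)
    }

  ∈vertexList⇒InImage : ∀ {v} → v ∈ vertexList → InImage union D vertex v
  ∈vertexList⇒InImage v∈ = Any.index v∈ , sym (lookup-index v∈)

  lift : (σ : DPath D) → (∀ {v} → v ∈ verts σ → v ∈ verts π ++ verts ρ) →
         (∀ {u v} → Consec u v (verts σ) → OnUnion u v) →
         Σ (DPath union) λ σ̂ → map vertex (verts σ̂) ≡ verts σ
  lift σ σ⊆ σ-arcs = liftPath union⊆D σ
    (All.tabulate (λ v∈ → ∈vertexList⇒InImage (∈-deduplicate⁺ _≟_ (σ⊆ v∈))))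
    (λ {i} {j} c → dec-true (onUnion? (vertex i) (vertex j)) (σ-arcs c))

  π̂-lift : Σ (DPath union) λ π̂ → map vertex (verts π̂) ≡ verts π
  π̂-lift = lift π ∈-++⁺ˡ inj₁

  ρ̂-lift : Σ (DPath union) λ ρ̂ → map vertex (verts ρ̂) ≡ verts ρ
  ρ̂-lift = lift ρ (∈-++⁺ʳ (verts π)) inj₂

  π̂ ρ̂ : DPath union
  π̂ = proj₁ π̂-lift
  ρ̂ = proj₁ ρ̂-lift

  module Liftπ = Lifted union⊆D {π̂} {π} (proj₂ π̂-lift)
  module Liftρ = Lifted union⊆D {ρ̂} {ρ} (proj₂ ρ̂-lift)

  vertex-cover : ∀ i → i ∈ verts π̂ ⊎ i ∈ verts ρ̂
  vertex-cover i with ∈-++⁻ (verts π) (∈-deduplicate⁻ _≟_ (verts π ++ verts ρ) (∈-lookup i))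
  ... | inj₁ i∈π = inj₁ (Liftπ.lift-∈ i∈π)
  ... | inj₂ i∈ρ = inj₂ (Liftρ.lift-∈ i∈ρ)

  arc-cover : ∀ i j → Arc union i j → Consec i j (verts π̂) ⊎ Consec i j (verts ρ̂)
  arc-cover i j a with does-true⇒ (onUnion? (vertex i) (vertex j)) a
  ... | inj₁ c = inj₁ (Liftπ.lift-Consec c)
  ... | inj₂ c = inj₂ (Liftρ.lift-Consec c)

  union-GPC : end π ≡ start ρ → end ρ ≡ start π → GPC (PathDigraph (len π)) union
  union-GPC π→ρ ρ→π = subst (λ k → GPC (PathDigraph k) union) Liftπ.lift-len
    (twoPaths⇒GPC π̂ ρ̂ vertex-cover
      (lifted π→ρ Liftπ.lift-end Liftρ.lift-start) (lifted ρ→π Liftρ.lift-end Liftπ.lift-start) arc-cover)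
    where
    lifted : ∀ {x y i j} → x ≡ y → vertex i ≡ x → vertex j ≡ y → i ≡ j
    lifted x≡y i↦x j↦y = Subgraph.injective union⊆D (trans i↦x (trans x≡y (sym j↦y)))

longPath⇒GPC-subgraph : ∀ {D : Digraph} {p} → StronglyConnected D → (σ : DPath D) → p ≤ len σ →
  ∃[ H′ ] (Subgraph H′ D × GPC (PathDigraph p) H′)
longPath⇒GPC-subgraph {p = p} strongD σ p≤σ with Reach⇒DPath (strongD (end (takePath p σ)) (start σ))
... | ρ , ρ-start , ρ-end =
  union , union⊆D , subst (λ k → GPC (PathDigraph k) union) (len-takePath σ p≤σ) (union-GPC (sym ρ-start) ρ-end)
  where open PathUnion (takePath p σ) ρ

module _ {𝓗 : List Digraph} {p : ℕ} {G : Digraph} where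

  Plus⇒StronglyConnected : Plus 𝓗 p G → StronglyConnected G
  Plus⇒StronglyConnected ((_ , _ , W) , _) = strong W

  Plus⇒longPath : Plus 𝓗 p G → Σ (DPath G) λ σ → p ≤ len σ
  Plus⇒longPath ((H , H∈𝓗 , W) , ¬minus) with All.all? (λ σ → len σ <? p) (paths W)
  ... | yes short = ⊥-elim (¬minus (H , H∈𝓗 , W , short))
  ... | no ¬short with Any.satisfied (¬All⇒Any¬ (λ σ → len σ <? p) (paths W) ¬short)
  ...   | σ , σ≮p = σ , ≮⇒≥ σ≮p

lemma24 : (𝓗 : List Digraph) (P : Digraph) (p : ℕ) → P ∈ 𝓗 → IsDirectedPath P p →
    (Hs : Digraph) → Plus 𝓗 p Hs →
    ∃[ H′ ] (Subgraph H′ Hs × ∃[ G ] (GPC P G × Iso H′ G))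
lemma24 𝓗 P p _ P≅path Hs plus with Plus⇒longPath plus
... | σ , p≤σ with longPath⇒GPC-subgraph (Plus⇒StronglyConnected plus) σ p≤σ
...   | H′ , H′⊆Hs , H′∈GPC = H′ , H′⊆Hs , H′ , GPC-resp-Iso P≅path H′∈GPC , Iso-refl
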